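{- In the Slow Flashcard Game, for all positive integers $k$ and $i$ with $\binom{i+1}{2}<k$, we have $T_k(i+1)-T_k(i)=i+1$.
   Context: The Slow Flashcard Game is the following deterministic process with insertion sequence $p_k=k+1$. The state at each time $t=1,2,\dots$ consists of an ordering (the deck) of all positive integers (cards), positions numbered $1,2,\dots$ from the front, together with a counter for each card recording how many times it has been seen. At time $t=1$ the deck is $1,2,3,\dots$, card $1$ (at the front) has been seen once, and all other cards $0$ times. To pass from time $t$ to $t+1$: if the front card has been seen $k$ times so far, remove it and reinsert it so that it occupies position $k+1$; then the card now at the front has its counter increased by one (it is seen at time $t+1$). For $n,k\ge1$, $T_n(k)$ denotes the time at which card $n$ is seen for the $k$-th time. -}

module Defs where

open import Data.Nat using (ℕ; zero; suc; _+_; _≤_; _<ᵇ_; _≡ᵇ_)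
open import Data.Bool using (Bool; true; false; if_then_else_)
open import Data.Product using (_×_; _,_; proj₁; proj₂)
open import Relation.Binary.PropositionalEquality using (_≡_)

-- A state of the Slow Flashcard Game (insertion sequence p_k = k+1):
--   deck  : position (0-indexed: index j is position j+1) → card
--   count : card → number of times it has been seen so far
record State : Set where
  constructor mkState
  field
    deck  : ℕ → ℕ
    count : ℕ → ℕ
open State public

initState : State
initState = mkState (λ j → suc j) (λ c → if c ≡ᵇ 1 then 1 else 0)

-- Passing from time t to t+1: the front card f, seen k times, is removed
-- and reinserted at position k+1 (index k); then the new front card's
-- counter is increased by one.
step : State → State
step s = mkState d' c'
  where
  f : ℕ
  f = deck s 0
  k : ℕ
  k = count s f
  d' : ℕ → ℕ
  d' j = if j <ᵇ k then deck s (suc j) else (if j ≡ᵇ k then f else deck s j)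
  c' : ℕ → ℕ
  c' c = if c ≡ᵇ d' 0 then suc (count s c) else count s c

-- stateAt t = the state at time t, for t ≥ 1 (stateAt 0 is a dummy
-- equal to the initial state and is never used).
stateAt : ℕ → State
stateAt zero = initState
stateAt (suc zero) = initState
stateAt (suc (suc t)) = step (stateAt (suc t))

seenAt : ℕ → ℕ
seenAt t = deck (stateAt t) 0

timesSeen : ℕ → ℕ → ℕ
timesSeen n zero = 0
timesSeen n (suc t) = timesSeen n t + (if seenAt (suc t) ≡ᵇ n then 1 else 0)

-- IsT n k t : t is the time at which card n is seen for the k-th time,
-- i.e. T_n(k) = t.
IsT : ℕ → ℕ → ℕ → Set
IsT n k t = (1 ≤ t) × (seenAt t ≡ n) × (timesSeen n t ≡ k)

-- Let v(c) be the number of earlier sightings of card c. Throughout the game a smaller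
-- card has v at least that of a larger one, strictly so if it lies behind it (this needs
-- the auxiliary fact that a card seen v > 0 times lies among the first v + 1 positions).
-- While card k + 1 is still unseen, every card in front of k is smaller, hence seen at
-- least as often as k, so it is reinserted behind k: after its i-th sighting card k is
-- reinserted at position i + 1 and moves up one place per step, so it is seen again
-- exactly i + 1 steps later. Card k + 1 sits at position k + 1 when k is first seen and
-- moves up at most one place whenever k does, so by the (i + 1)-th sighting of k it has
-- gained at most 1 + 2 + … + i = C(i + 1, 2) places; the hypothesis C(i + 1, 2) < k
-- therefore keeps it behind k, and unseen, throughout.
module Submission where

open import Defs
open import Data.Nat using (ℕ; zero; suc; _+_; _∸_; _≤_; _<_; _≡ᵇ_; z≤n; s≤s; z<s; s<s; s≤s⁻¹; s<s⁻¹)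
open import Data.Nat.Properties
open import Data.Nat.Combinatorics using (_C_; nC1≡n; nCk+nC[k+1]≡[n+1]C[k+1])
open import Data.Bool using (if_then_else_)
open import Function using (_∘_)
open import Data.Product using (Σ; ∃; ∃₂; _×_; _,_)
open import Data.Sum using (_⊎_; inj₁; inj₂)
open import Relation.Nullary using (¬_; Dec; does; yes; no; contradiction)
open import Relation.Nullary.Decidable using (dec-true; dec-false)
open import Relation.Binary using (tri<; tri≈; tri>)
open import Relation.Binary.PropositionalEquality

if-does-yes : ∀ {P A : Set} {x y : A} (P? : Dec P) → P → (if does P? then x else y) ≡ x
if-does-yes P? p rewrite dec-true P? p = refl

if-does-no : ∀ {P A : Set} {x y : A} (P? : Dec P) → ¬ P → (if does P? then x else y) ≡ y
if-does-no P? ¬p rewrite dec-false P? ¬p = refl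

frontCount : State → ℕ
frontCount s = count s (deck s 0)

module _ (s : State) where

  deck-step-< : ∀ {j} → j < frontCount s → deck (step s) j ≡ deck s (suc j)
  deck-step-< {j} = if-does-yes (j <? frontCount s)

  deck-step-frontCount : deck (step s) (frontCount s) ≡ deck s 0
  deck-step-frontCount = trans (if-does-no (c <? c) (n≮n c)) (if-does-yes (c ≟ c) refl)
    where c = frontCount s

  deck-step-> : ∀ {j} → frontCount s < j → deck (step s) j ≡ deck s j
  deck-step-> {j} c<j =
    trans (if-does-no (j <? frontCount s) (<⇒≯ c<j)) (if-does-no (j ≟ frontCount s) (>⇒≢ c<j))

  count-step-seen : ∀ {x} → x ≡ deck (step s) 0 → count (step s) x ≡ suc (count s x)
  count-step-seen {x} = if-does-yes (x ≟ deck (step s) 0)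

  count-step-unseen : ∀ {x} → ¬ x ≡ deck (step s) 0 → count (step s) x ≡ count s x
  count-step-unseen {x} = if-does-no (x ≟ deck (step s) 0)

  count-step-≤ : ∀ x → count s x ≤ count (step s) x
  count-step-≤ x with x ≟ deck (step s) 0
  ... | yes x≡f = ≤-trans (n≤1+n _) (≤-reflexive (sym (count-step-seen x≡f)))
  ... | no x≢f = ≤-reflexive (sym (count-step-unseen x≢f))

newPosition : ℕ → ℕ → ℕ
newPosition c zero = c
newPosition c (suc q) with q <? c
... | yes _ = q
... | no _ = suc q

newPosition-< : ∀ {c q} → q < c → newPosition c (suc q) ≡ q
newPosition-< {c} {q} q<c with q <? c
... | yes _ = refl
... | no q≮c = contradiction q<c q≮c

newPosition-> : ∀ {c p} → c < p → newPosition c p ≡ p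
newPosition-> {c} {suc q} c<p with q <? c
... | yes q<c = contradiction q<c (≤⇒≯ (s≤s⁻¹ c<p))
... | no _ = refl

newPosition-suc-≤ : ∀ c q → newPosition c (suc q) ≤ suc q
newPosition-suc-≤ c q with q <? c
... | yes _ = n≤1+n q
... | no _ = ≤-refl

≤-newPosition-suc : ∀ c q → q ≤ newPosition c (suc q)
≤-newPosition-suc c q with q <? c
... | yes _ = ≤-refl
... | no _ = n≤1+n q

newPosition-suc-cancel-< : ∀ c p q → newPosition c (suc p) < newPosition c (suc q) → p < q
newPosition-suc-cancel-< c p q lt with p <? c | q <? c
... | yes _ | yes _ = lt
... | yes p<c | no q≮c = <-≤-trans p<c (≮⇒≥ q≮c)
... | no _ | yes _ = <-trans (n<1+n p) lt
... | no _ | no _ = s<s⁻¹ lt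

newPosition-suc-> : ∀ c q → c < newPosition c (suc q) → c ≤ q
newPosition-suc-> c q c<new with q <? c
... | yes q<c = contradiction q<c (<⇒≯ c<new)
... | no q≮c = ≮⇒≥ q≮c

newPosition-surjective : ∀ c p → ∃ λ q → newPosition c q ≡ p
newPosition-surjective c p with <-cmp p c
... | tri< p<c _ _ = suc p , newPosition-< p<c
... | tri≈ _ p≡c _ = zero , sym p≡c
newPosition-surjective c (suc p) | tri> _ _ c<p = suc p , newPosition-> c<p

deck-step-newPosition : ∀ s q → deck (step s) (newPosition (frontCount s) q) ≡ deck s q
deck-step-newPosition s zero = deck-step-frontCount s
deck-step-newPosition s (suc q) with q <? frontCount s
... | yes q<c = deck-step-< s q<c
... | no q≮c = deck-step-> s (s≤s (≮⇒≥ q≮c))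

-- The number of times the card at position p was seen before the current time: the
-- current sighting of the front card is not counted.
views : State → ℕ → ℕ
views s zero = frontCount s ∸ 1
views s (suc p) = count s (deck s (suc p))

views-nonfront : ∀ s {p} → 1 ≤ p → views s p ≡ count s (deck s p)
views-nonfront s {suc p} _ = refl

record Invariant (s : State) : Set where
  field
    deck-injective : ∀ {p q} → deck s p ≡ deck s q → p ≡ q
    front-seen : 1 ≤ frontCount s
    unseen⊎position≤views : ∀ p → views s p ≡ 0 ⊎ p ≤ views s p
    smaller-seen-more : ∀ {p q} → deck s p < deck s q → views s q ≤ views s p
    smaller-behind-seen-more : ∀ {p q} → deck s p < deck s q → q < p → views s q < views s p
open Invariant

module _ {s : State} (I : Invariant s) where

  frontCount≡suc-views : frontCount s ≡ suc (views s 0)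
  frontCount≡suc-views = sym (m+[n∸m]≡n (front-seen I))

  deck-step-0 : deck (step s) 0 ≡ deck s 1
  deck-step-0 = deck-step-< s (front-seen I)

  new-front⇒position-1 : ∀ {p} → deck s p ≡ deck (step s) 0 → p ≡ 1
  new-front⇒position-1 eq = deck-injective I (trans eq deck-step-0)

  views-step-frontCount : views (step s) (frontCount s) ≡ suc (views s 0)
  views-step-frontCount = begin
      views (step s) (frontCount s)
    ≡⟨ views-nonfront (step s) (front-seen I) ⟩
      count (step s) (deck (step s) (frontCount s))
    ≡⟨ cong (count (step s)) (deck-step-frontCount s) ⟩
      count (step s) (deck s 0)
    ≡⟨ count-step-unseen s (0≢1+n ∘ new-front⇒position-1) ⟩
      frontCount s
    ≡⟨ frontCount≡suc-views ⟩
      suc (views s 0) ∎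
    where open ≡-Reasoning

  views-step-suc : ∀ q → views (step s) (newPosition (frontCount s) (suc q)) ≡ views s (suc q)
  views-step-suc q with q <? frontCount s
  views-step-suc zero | yes _ =
    cong (_∸ 1) (trans (cong (count (step s)) deck-step-0) (count-step-seen s (sym deck-step-0)))
  views-step-suc (suc q) | yes q<c =
    trans (cong (count (step s)) (deck-step-< s q<c))
          (count-step-unseen s (1+n≢0 ∘ suc-injective ∘ new-front⇒position-1))
  ... | no q≮c =
    trans (cong (count (step s)) (deck-step-> s (s≤s (≮⇒≥ q≮c))))
          (count-step-unseen s λ eq → q≮c (subst (_< frontCount s)
            (sym (suc-injective (new-front⇒position-1 eq))) (front-seen I)))

  views-step-≤ : ∀ q → views s q ≤ views (step s) (newPosition (frontCount s) q)
  views-step-≤ zero = ≤-trans (n≤1+n _) (≤-reflexive (sym views-step-frontCount))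
  views-step-≤ (suc q) = ≤-reflexive (sym (views-step-suc q))

  deck-injective-step : ∀ {p q} → deck (step s) p ≡ deck (step s) q → p ≡ q
  deck-injective-step {p} {q} eq
    with newPosition-surjective (frontCount s) p | newPosition-surjective (frontCount s) q
  ... | a , refl | b , refl = cong (newPosition (frontCount s)) (deck-injective I
    (trans (sym (deck-step-newPosition s a)) (trans eq (deck-step-newPosition s b))))

  unseen⊎position≤views-step : ∀ p → views (step s) p ≡ 0 ⊎ p ≤ views (step s) p
  unseen⊎position≤views-step p with newPosition-surjective (frontCount s) p
  ... | zero , refl = inj₂ (≤-reflexive (trans frontCount≡suc-views (sym views-step-frontCount)))
  ... | suc a , refl with unseen⊎position≤views I (suc a)
  ...   | inj₁ unseen = inj₁ (trans (views-step-suc a) unseen)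
  ...   | inj₂ a≤v =
    inj₂ (≤-trans (newPosition-suc-≤ (frontCount s) a) (≤-trans a≤v (views-step-≤ (suc a))))

  deck-step-newPosition-< : ∀ a b →
    deck (step s) (newPosition (frontCount s) a) < deck (step s) (newPosition (frontCount s) b) →
    deck s a < deck s b
  deck-step-newPosition-< a b = subst₂ _<_ (deck-step-newPosition s a) (deck-step-newPosition s b)

  smaller-seen-more-step : ∀ {p q} → deck (step s) p < deck (step s) q →
                           views (step s) q ≤ views (step s) p
  smaller-seen-more-step {p} {q} lt
    with newPosition-surjective (frontCount s) p | newPosition-surjective (frontCount s) q
  ... | zero , refl | zero , refl = contradiction lt (n≮n _)
  ... | suc a , refl | zero , refl =
    subst₂ _≤_ (sym views-step-frontCount) (sym (views-step-suc a))
      (smaller-behind-seen-more I (deck-step-newPosition-< (suc a) 0 lt) z<s)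
  ... | a , refl | suc b , refl =
    subst (_≤ views (step s) (newPosition (frontCount s) a)) (sym (views-step-suc b))
      (≤-trans (smaller-seen-more I (deck-step-newPosition-< a (suc b) lt)) (views-step-≤ a))

  smaller-behind-seen-more-step : ∀ {p q} → deck (step s) p < deck (step s) q → q < p →
                                  views (step s) q < views (step s) p
  smaller-behind-seen-more-step {p} {q} lt q<p
    with newPosition-surjective (frontCount s) p | newPosition-surjective (frontCount s) q
  ... | zero , refl | zero , refl = contradiction lt (n≮n _)
  ... | zero , refl | suc b , refl =
    subst₂ _<_ (sym (views-step-suc b)) (sym views-step-frontCount)
      (s≤s (smaller-seen-more I (deck-step-newPosition-< 0 (suc b) lt)))
  ... | suc a , refl | suc b , refl =
    subst₂ _<_ (sym (views-step-suc b)) (sym (views-step-suc a))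
      (smaller-behind-seen-more I (deck-step-newPosition-< (suc a) (suc b) lt)
        (s<s (newPosition-suc-cancel-< (frontCount s) b a q<p)))
  -- The smaller card now lies behind the old front card, beyond position frontCount s,
  -- so the position bound gives it more than frontCount s sightings.
  ... | suc a , refl | zero , refl with unseen⊎position≤views I (suc a)
  ...   | inj₁ unseen =
    contradiction (subst (views s 0 <_) unseen
      (smaller-behind-seen-more I (deck-step-newPosition-< (suc a) 0 lt) z<s)) λ ()
  ...   | inj₂ a≤v = subst₂ _<_ (sym views-step-frontCount) (sym (views-step-suc a))
    (<-≤-trans (s≤s (subst (_≤ a) frontCount≡suc-views (newPosition-suc-> (frontCount s) a q<p)))
               a≤v)

  invariant-step : Invariant (step s)
  invariant-step = record
    { deck-injective = deck-injective-step
    ; front-seen = subst (1 ≤_) (sym (count-step-seen s refl)) (s≤s z≤n)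
    ; unseen⊎position≤views = unseen⊎position≤views-step
    ; smaller-seen-more = smaller-seen-more-step
    ; smaller-behind-seen-more = smaller-behind-seen-more-step
    }

views-init : ∀ p → views initState p ≡ 0
views-init zero = refl
views-init (suc p) = refl

invariant-init : Invariant initState
invariant-init = record
  { deck-injective = suc-injective
  ; front-seen = s≤s z≤n
  ; unseen⊎position≤views = λ p → inj₁ (views-init p)
  ; smaller-seen-more = λ {p} {q} _ → ≤-reflexive (trans (views-init q) (sym (views-init p)))
  ; smaller-behind-seen-more = λ lt q<p → contradiction (s<s⁻¹ lt) (<⇒≯ q<p)
  }

stateAfter : ℕ → State
stateAfter τ = stateAt (suc τ)

invariant : ∀ τ → Invariant (stateAfter τ)
invariant zero = invariant-init
invariant (suc τ) = invariant-step (invariant τ)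

-- The bounds on views keep every reinsertion in front of position u.
record FreshAt (u P : ℕ) (s : State) : Set where
  field
    at : deck s P ≡ u
    untouched : ∀ p → u ≤ p → deck s p ≡ suc p
    views< : ∀ p → views s p < u
    ahead-views< : ∀ p → p < P → suc (views s p) < u
    unseen : views s P ≡ 0
    untouched-unseen : ∀ p → u ≤ p → views s p ≡ 0
open FreshAt

module _ {u P : ℕ} {s : State} (F : FreshAt u P s) where

  position<fresh : P < u
  position<fresh with P <? u
  ... | yes P<u = P<u
  ... | no P≮u = contradiction (subst (_≤ P) (sym suc[P]≡u) u≤P) (n≮n P)
    where
    u≤P = ≮⇒≥ P≮u
    suc[P]≡u = trans (sym (untouched F P u≤P)) (at F)

  ahead<fresh : Invariant s → ∀ {p} → p < P → deck s p < u
  ahead<fresh I {p} p<P with <-cmp (deck s p) u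
  ... | tri< lt _ _ = lt
  ... | tri≈ _ eq _ = contradiction (deck-injective I (trans eq (sym (at F)))) (<⇒≢ p<P)
  ... | tri> _ _ gt = contradiction (<-≤-trans (<-trans p<P position<fresh) u≤w) (<-irrefl p≡w)
    where
    w = deck s p ∸ 1
    suc[w]≡deck : suc w ≡ deck s p
    suc[w]≡deck = m+[n∸m]≡n (≤-trans (s≤s z≤n) gt)
    u≤w : u ≤ w
    u≤w = s≤s⁻¹ (subst (u <_) (sym suc[w]≡deck) gt)
    p≡w : p ≡ w
    p≡w = deck-injective I (trans (sym suc[w]≡deck) (sym (untouched F w u≤w)))

freshAt-step : ∀ {u P s} → Invariant s → FreshAt u P s → 1 ≤ P →
               FreshAt u (newPosition (frontCount s) P) (step s)
freshAt-step {u} {suc P} {s} I F _ = record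
  { at = trans (deck-step-newPosition s (suc P)) (at F)
  ; untouched = λ p u≤p → trans (deck-step-> s (<-≤-trans c<u u≤p)) (untouched F p u≤p)
  ; views< = moved-views<
  ; ahead-views< = moved-ahead-views<
  ; unseen = trans (views-step-suc I P) (unseen F)
  ; untouched-unseen = moved-untouched-unseen
  }
  where
  c = frontCount s
  front-views< : suc (views s 0) < u
  front-views< = ahead-views< F 0 z<s
  c<u : c < u
  c<u = subst (_< u) (sym (frontCount≡suc-views I)) front-views<
  moved-views< : ∀ p → views (step s) p < u
  moved-views< p with newPosition-surjective c p
  ... | zero , refl = subst (_< u) (sym (views-step-frontCount I)) front-views<
  ... | suc a , refl = subst (_< u) (sym (views-step-suc I a)) (views< F (suc a))
  moved-ahead-views< : ∀ p → p < newPosition c (suc P) → suc (views (step s) p) < u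
  moved-ahead-views< p lt with newPosition-surjective c p
  ... | zero , refl = subst (λ v → suc v < u) (sym (views-step-frontCount I))
    (≤-<-trans (s≤s (subst (_≤ P) (frontCount≡suc-views I) (newPosition-suc-> c P lt)))
               (position<fresh F))
  ... | suc a , refl = subst (λ v → suc v < u) (sym (views-step-suc I a))
    (ahead-views< F (suc a) (s<s (newPosition-suc-cancel-< c a P lt)))
  moved-untouched-unseen : ∀ p → u ≤ p → views (step s) p ≡ 0
  moved-untouched-unseen zero u≤0 = contradiction (<-≤-trans c<u u≤0) λ ()
  moved-untouched-unseen (suc p) u≤p = begin
      views (step s) (suc p)
    ≡⟨ cong (views (step s)) (sym (newPosition-> (<-≤-trans c<u u≤p))) ⟩
      views (step s) (newPosition c (suc p))
    ≡⟨ views-step-suc I p ⟩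
      views s (suc p)
    ≡⟨ untouched-unseen F (suc p) u≤p ⟩
      0 ∎
    where open ≡-Reasoning

freshAt-next : ∀ {u s} → FreshAt u 0 s → FreshAt (suc u) u s
freshAt-next {u} F = record
  { at = untouched F u ≤-refl
  ; untouched = λ p u<p → untouched F p (<⇒≤ u<p)
  ; views< = λ p → m<n⇒m<1+n (views< F p)
  ; ahead-views< = λ p _ → s<s (views< F p)
  ; unseen = untouched-unseen F u ≤-refl
  ; untouched-unseen = λ p u<p → untouched-unseen F p (<⇒≤ u<p)
  }

freshAt-init : FreshAt 2 1 initState
freshAt-init = record
  { at = refl
  ; untouched = λ _ _ → refl
  ; views< = λ p → subst (_< 2) (sym (views-init p)) z<s
  ; ahead-views< = λ { zero _ → s<s z<s ; (suc p) (s≤s ()) }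
  ; unseen = refl
  ; untouched-unseen = λ p _ → views-init p
  }

sum< : ℕ → (ℕ → ℕ) → ℕ
sum< zero f = 0
sum< (suc n) f = f n + sum< n f

sum<-mono-≤ : ∀ n {f g} → (∀ x → f x ≤ g x) → sum< n f ≤ sum< n g
sum<-mono-≤ zero f≤g = z≤n
sum<-mono-≤ (suc n) f≤g = +-mono-≤ (f≤g n) (sum<-mono-≤ n f≤g)

sum<-mono-< : ∀ n {f g y} → (∀ x → f x ≤ g x) → y < n → f y < g y → sum< n f < sum< n g
sum<-mono-< (suc n) {y = y} f≤g y<1+n fy<gy with m<1+n⇒m<n∨m≡n y<1+n
... | inj₁ y<n = +-mono-≤-< (f≤g n) (sum<-mono-< n f≤g y<n fy<gy)
... | inj₂ refl = +-mono-<-≤ fy<gy (sum<-mono-≤ n f≤g)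

-- Every card below u is seen fewer than u times, so this decreases whenever one of
-- them is seen.
slack : ℕ → State → ℕ
slack u s = sum< u (λ x → u ∸ count s x)

slack-step-≤ : ∀ u s → slack u (step s) ≤ slack u s
slack-step-≤ u s = sum<-mono-≤ u (λ x → ∸-monoʳ-≤ u (count-step-≤ s x))

slack-step-< : ∀ {u} s → deck (step s) 0 < u → count s (deck (step s) 0) < u →
               slack u (step s) < slack u s
slack-step-< {u} s y<u count<u = sum<-mono-< u (λ x → ∸-monoʳ-≤ u (count-step-≤ s x)) y<u
  (subst (λ n → u ∸ n < u ∸ count s (deck (step s) 0)) (sym (count-step-seen s refl))
         (∸-monoʳ-< (n<1+n _) count<u))

freshAt-step-progress : ∀ {u P s} → Invariant s → FreshAt u (suc P) s →
  ∃ λ P′ → FreshAt u P′ (step s) × slack u (step s) + P′ < slack u s + suc P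
freshAt-step-progress {u} {P} {s} I F with P <? frontCount s
... | yes P<c = P , subst (λ p → FreshAt u p (step s)) (newPosition-< P<c) (freshAt-step I F z<s)
              , +-mono-≤-< (slack-step-≤ u s) (n<1+n P)
... | no P≮c = suc P
             , subst (λ p → FreshAt u p (step s)) (newPosition-> (s≤s c≤P)) (freshAt-step I F z<s)
             , +-mono-<-≤ (slack-step-< s seen<u seen-count<u) ≤-refl
  where
  c≤P = ≮⇒≥ P≮c
  seen<u : deck (step s) 0 < u
  seen<u = subst (_< u) (sym (deck-step-0 I)) (ahead<fresh F I (s≤s (≤-trans (front-seen I) c≤P)))
  seen-count<u : count s (deck (step s) 0) < u
  seen-count<u = subst (λ y → count s y < u) (sym (deck-step-0 I)) (views< F 1)

reachFront : ∀ n {u τ P} → slack u (stateAfter τ) + P ≤ n → FreshAt u P (stateAfter τ) →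
             ∃ λ τ′ → FreshAt u 0 (stateAfter τ′)
reachFront _ {τ = τ} {zero} _ F = τ , F
reachFront zero {P = suc P} bound F = contradiction (≤-trans (m≤n+m (suc P) _) bound) λ ()
reachFront (suc n) {τ = τ} {suc P} bound F with freshAt-step-progress (invariant τ) F
... | P′ , F′ , progress = reachFront n {τ = suc τ} (s≤s⁻¹ (<-≤-trans progress bound)) F′

-- At time τ + 1 card k is seen for the (j + 1)-th time, while card k + 1 is still
-- unseen, far enough behind.
record Sighting (k j τ : ℕ) : Set where
  field
    front : deck (stateAfter τ) 0 ≡ k
    previous : views (stateAfter τ) 0 ≡ j
    successorAt : ℕ
    successor-fresh : FreshAt (suc k) successorAt (stateAfter τ)
    successor-far : k ≤ successorAt + suc j C 2
open Sighting

firstSighting : ∀ {k} → 1 ≤ k → ∃ (Sighting k 0)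
firstSighting {suc zero} _ = 0 , record
  { front = refl ; previous = refl ; successorAt = 1
  ; successor-fresh = freshAt-init ; successor-far = ≤-refl }
firstSighting {suc (suc k)} _ with firstSighting {suc k} (s≤s z≤n)
... | τ , S with reachFront _ ≤-refl (successor-fresh S)
... | τ′ , F = τ′ , record
  { front = at F ; previous = unseen F ; successorAt = suc (suc k)
  ; successor-fresh = freshAt-next F ; successor-far = m≤m+n _ 0 }

-- A card k at position d ≤ m + 1 with m earlier sightings reaches the front in d steps:
-- every card in front of it is smaller (card k + 1 being unseen), so it has been seen at
-- least m times and is reinserted behind k.
advance : ∀ d {τ P k m} → FreshAt (suc k) P (stateAfter τ) → deck (stateAfter τ) d ≡ k →
  d < P → views (stateAfter τ) d ≡ m → d ≤ suc m →
  ∃₂ λ τ′ P′ → τ′ ≡ τ + d × deck (stateAfter τ′) 0 ≡ k × views (stateAfter τ′) 0 ≡ m ×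
               FreshAt (suc k) P′ (stateAfter τ′) × P ≤ P′ + d
advance zero {τ} {P} F at-d _ views-d _ =
  τ , P , sym (+-identityʳ τ) , at-d , views-d , F , m≤m+n P 0
advance (suc d) {τ} {suc P} {k} {m} F at-d 1+d<1+P views-d 1+d≤1+m
  with advance d {suc τ} F′ at-d′ d<P′ views-d′ (m≤n⇒m≤1+n (s≤s⁻¹ 1+d≤1+m))
  where
  s = stateAfter τ
  I = invariant τ
  c = frontCount s
  front<k : deck s 0 < k
  front<k = ≤∧≢⇒< (s≤s⁻¹ (ahead<fresh F I z<s))
                  (λ eq → 0≢1+n (deck-injective I (trans eq (sym at-d))))
  m≤front : m ≤ views s 0
  m≤front = subst (_≤ views s 0) views-d
    (smaller-seen-more I (subst (deck s 0 <_) (sym at-d) front<k))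
  d<c : d < c
  d<c = subst (d <_) (sym (frontCount≡suc-views I)) (s≤s (≤-trans (s≤s⁻¹ 1+d≤1+m) m≤front))
  F′ = freshAt-step I F z<s
  at-d′ : deck (step s) d ≡ k
  at-d′ = trans (cong (deck (step s)) (sym (newPosition-< d<c)))
                (trans (deck-step-newPosition s (suc d)) at-d)
  views-d′ : views (step s) d ≡ m
  views-d′ = trans (cong (views (step s)) (sym (newPosition-< d<c)))
                   (trans (views-step-suc I d) views-d)
  d<P′ : d < newPosition c (suc P)
  d<P′ = <-≤-trans (s<s⁻¹ 1+d<1+P) (≤-newPosition-suc c P)
... | _ , P′ , refl , at-0 , views-0 , F″ , moved≤P′+d =
  _ , P′ , sym (+-suc τ d) , at-0 , views-0 , F″ , subst (suc P ≤_) (sym (+-suc P′ d))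
    (s≤s (≤-trans (≤-newPosition-suc (frontCount (stateAfter τ)) P) moved≤P′+d))

suc[n]C2≡n+nC2 : ∀ n → suc n C 2 ≡ n + n C 2
suc[n]C2≡n+nC2 n = trans (sym (nCk+nC[k+1]≡[n+1]C[k+1] n 1)) (cong (_+ n C 2) (nC1≡n n))

nC2≤suc[n]C2 : ∀ n → n C 2 ≤ suc n C 2
nC2≤suc[n]C2 n = subst (n C 2 ≤_) (sym (suc[n]C2≡n+nC2 n)) (m≤n+m _ n)

nextSighting : ∀ {k j τ} → Sighting k j τ → suc (suc j) C 2 < k →
               Sighting k (suc j) (τ + suc (suc j))
nextSighting {k} {j} {τ} S bound
  with advance (suc j) {suc τ} F′ at-c 1+j<P views-c (n≤1+n (suc j))
  where
  s = stateAfter τ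
  I = invariant τ
  P = successorAt S
  c≡1+j : frontCount s ≡ suc j
  c≡1+j = trans (frontCount≡suc-views I) (cong suc (previous S))
  1+j<P : suc j < P
  1+j<P = +-cancelʳ-< (suc j C 2) (suc j) P (<-≤-trans
    (subst (_< k) (suc[n]C2≡n+nC2 (suc j)) bound) (successor-far S))
  c<P : frontCount s < P
  c<P = subst (_< P) (sym c≡1+j) 1+j<P
  F′ : FreshAt (suc k) P (step s)
  F′ = subst (λ p → FreshAt (suc k) p (step s)) (newPosition-> c<P)
             (freshAt-step I (successor-fresh S) (≤-trans (s≤s z≤n) c<P))
  at-c : deck (step s) (suc j) ≡ k
  at-c = subst (λ p → deck (step s) p ≡ k) c≡1+j (trans (deck-step-frontCount s) (front S))
  views-c : views (step s) (suc j) ≡ suc j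
  views-c = subst (λ p → views (step s) p ≡ suc j) c≡1+j
                  (trans (views-step-frontCount I) (cong suc (previous S)))
... | _ , P′ , refl , at-0 , views-0 , F″ , P≤P′+1+j =
  subst (Sighting k (suc j)) (sym (+-suc τ (suc j))) record
  { front = at-0 ; previous = views-0 ; successorAt = P′ ; successor-fresh = F″
  ; successor-far = begin
      k                                   ≤⟨ successor-far S ⟩
      successorAt S + suc j C 2           ≤⟨ +-monoˡ-≤ (suc j C 2) P≤P′+1+j ⟩
      P′ + suc j + suc j C 2              ≡⟨ +-assoc P′ (suc j) (suc j C 2) ⟩
      P′ + (suc j + suc j C 2)            ≡⟨ cong (P′ +_) (sym (suc[n]C2≡n+nC2 (suc j))) ⟩
      P′ + suc (suc j) C 2                ∎ }
  where open ≤-Reasoning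

sighting : ∀ {k} j → suc j C 2 < k → ∃ (Sighting k j)
sighting zero bound = firstSighting bound
sighting (suc j) bound with sighting j (≤-<-trans (nC2≤suc[n]C2 (suc j)) bound)
... | τ , S = τ + suc (suc j) , nextSighting S bound

timesSeen≡count : ∀ τ n → timesSeen n (suc τ) ≡ count (stateAfter τ) n
timesSeen≡count zero zero = refl
timesSeen≡count zero (suc zero) = refl
timesSeen≡count zero (suc (suc n)) = refl
timesSeen≡count (suc τ) n with n ≟ deck (stateAfter (suc τ)) 0
... | yes n≡f = begin
    timesSeen n (suc τ) + (if f ≡ᵇ n then 1 else 0)
  ≡⟨ cong₂ _+_ (timesSeen≡count τ n) (if-does-yes (f ≟ n) (sym n≡f)) ⟩
    count s n + 1
  ≡⟨ +-comm _ 1 ⟩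
    suc (count s n)
  ≡⟨ sym (count-step-seen s n≡f) ⟩
    count (step s) n ∎
  where
  open ≡-Reasoning
  s = stateAfter τ
  f = deck (step s) 0
... | no n≢f = begin
    timesSeen n (suc τ) + (if f ≡ᵇ n then 1 else 0)
  ≡⟨ cong₂ _+_ (timesSeen≡count τ n) (if-does-no (f ≟ n) (n≢f ∘ sym)) ⟩
    count s n + 0
  ≡⟨ +-identityʳ _ ⟩
    count s n
  ≡⟨ sym (count-step-unseen s n≢f) ⟩
    count (step s) n ∎
  where
  open ≡-Reasoning
  s = stateAfter τ
  f = deck (step s) 0

sighting-isT : ∀ {k j τ} → Sighting k j τ → IsT k (suc j) (suc τ)
sighting-isT {k} {j} {τ} S = s≤s z≤n , front S , (begin
    timesSeen k (suc τ)   ≡⟨ timesSeen≡count τ k ⟩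
    count s k             ≡⟨ cong (count s) (sym (front S)) ⟩
    frontCount s          ≡⟨ frontCount≡suc-views (invariant τ) ⟩
    suc (views s 0)       ≡⟨ cong suc (previous S) ⟩
    suc j                 ∎)
  where
  open ≡-Reasoning
  s = stateAfter τ

mainTheorem7 : (k i : ℕ) → 1 ≤ k → 1 ≤ i → (suc i) C 2 < k →
    Σ ℕ (λ t → IsT k i t × IsT k (suc i) (t + suc i))
mainTheorem7 k zero _ () _
mainTheorem7 k (suc i) _ _ bound with sighting i (≤-<-trans (nC2≤suc[n]C2 (suc i)) bound)
... | τ , S = suc τ , sighting-isT S , sighting-isT (nextSighting S bound)
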